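{- Let $I$ be an initial algebra of the class of all $\Sigma$-algebras satisfying $E_{\mathsf{ftc-cm}}$. Then $I$ satisfies $\mathsf{AVL}$: for all $x\in I$, if $\frac{1}{x}=\bot$ then $0\cdot x=x$.
   Context: $\Sigma$ is the signature with constants $0,1,\bot$, unary $-$, binary $+,\cdot,\div$; $x\div y$ is written $\frac{x}{y}$. $E_{\mathsf{ftc-cm}}$ is the following set of equations: $(x+y)+z=x+(y+z)$; $x+y=y+x$; $x+0=x$; $x+(-x)=0\cdot x$; $x\cdot(y\cdot z)=(x\cdot y)\cdot z$; $x\cdot y=y\cdot x$; $1\cdot x=x$; $x\cdot(y+z)=(x\cdot y)+(x\cdot z)$; $-(-x)=x$; $0\cdot(x\cdot x)=0\cdot x$; $x+\bot=\bot$; $x=\frac{x}{1}$; $\frac{x}{y}\cdot\frac{u}{v}=\frac{x\cdot u}{y\cdot v}$; $\frac{x}{y}+\frac{u}{v}=\frac{(x\cdot v)+(y\cdot u)}{y\cdot v}$; $\frac{x}{y+(0\cdot z)}=\frac{x+(0\cdot z)}{y}$; $\bot=\frac{1}{0}$. The initial algebra is the quotient of the closed $\Sigma$-terms by provable equality from $E_{\mathsf{ftc-cm}}$. -}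

module Defs where

data Term : Set where
  `0 `1 `⊥ : Term
  `-_      : Term → Term
  _`+_     : Term → Term → Term
  _`·_     : Term → Term → Term
  _`÷_     : Term → Term → Term

infixl 6 _`+_
infixl 7 _`·_
infixl 8 _`÷_
infix  9 `-_

-- Provable equality from E_ftc-cm between closed terms:
-- the least congruence on closed terms containing all closed
-- instances of the equations of E_ftc-cm.
infix 4 _≈_
data _≈_ : Term → Term → Set where
  refl  : ∀ {t} → t ≈ t
  sym   : ∀ {s t} → s ≈ t → t ≈ s
  trans : ∀ {s t r} → s ≈ t → t ≈ r → s ≈ r
  cong-  : ∀ {s t} → s ≈ t → `- s ≈ `- t
  cong+  : ∀ {s s' t t'} → s ≈ s' → t ≈ t' → s `+ t ≈ s' `+ t'
  cong·  : ∀ {s s' t t'} → s ≈ s' → t ≈ t' → s `· t ≈ s' `· t'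
  cong÷  : ∀ {s s' t t'} → s ≈ s' → t ≈ t' → s `÷ t ≈ s' `÷ t'
  +-assoc   : ∀ x y z → (x `+ y) `+ z ≈ x `+ (y `+ z)
  +-comm    : ∀ x y → x `+ y ≈ y `+ x
  +-idʳ     : ∀ x → x `+ `0 ≈ x
  +-inv     : ∀ x → x `+ (`- x) ≈ `0 `· x
  ·-assoc   : ∀ x y z → x `· (y `· z) ≈ (x `· y) `· z
  ·-comm    : ∀ x y → x `· y ≈ y `· x
  ·-idˡ     : ∀ x → `1 `· x ≈ x
  distrib   : ∀ x y z → x `· (y `+ z) ≈ (x `· y) `+ (x `· z)
  invol     : ∀ x → `- (`- x) ≈ x
  0·sq      : ∀ x → `0 `· (x `· x) ≈ `0 `· x
  +-⊥       : ∀ x → x `+ `⊥ ≈ `⊥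
  ÷-one     : ∀ x → x ≈ x `÷ `1
  ÷-mul     : ∀ x y u v → (x `÷ y) `· (u `÷ v) ≈ (x `· u) `÷ (y `· v)
  ÷-add     : ∀ x y u v → (x `÷ y) `+ (u `÷ v) ≈ ((x `· v) `+ (y `· u)) `÷ (y `· v)
  ÷-0       : ∀ x y z → x `÷ (y `+ (`0 `· z)) ≈ (x `+ (`0 `· z)) `÷ y
  ⊥-def     : `⊥ ≈ `1 `÷ `0

-- Every closed term is provably a fraction p ÷ q of integer numerals: closed ring terms
-- normalise to a difference m − n of numerals, and the ÷-axioms add, multiply and divide
-- fractions. If q is 0 the term equals p · ⊥ = 0 · (p · ⊥), and if p is 0 it equals
-- 0 · (1 ÷ q); either way it has the form 0 · y and is therefore fixed by 0 · _.
-- Otherwise p and q are nonzero integers, and evaluation in the common meadow ℚ ∪ {⊥}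
-- (division by 0 giving ⊥) shows 1 ÷ (p ÷ q) ≠ ⊥, contradicting the hypothesis.
module Submission where

open import Defs

open import Algebra.Bundles using (CommutativeSemigroup)
open import Algebra.Definitions using (Associative; Commutative)
import Algebra.Properties.CommutativeSemigroup as CommutativeSemigroupProperties
open import Algebra.Structures using (IsCommutativeSemigroup; IsCommutativeMonoid)
open import Data.Empty using (⊥; ⊥-elim)
open import Data.Maybe using (Maybe; just; nothing; map; zipWith; _>>=_)
open import Data.Nat as ℕ using (ℕ; zero; suc) renaming (_+_ to _+ℕ_; _*_ to _*ℕ_)
open import Data.Product using (∃₂; _,_)
open import Data.Rational using (ℚ; 0ℚ; 1ℚ; _+_; _*_; -_; _-_; 1/_; _≤_; _<_; ≢-nonZero)
open import Data.Rational.Properties as ℚₚ using (_≟_)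
open import Data.Rational.Solver using (module +-*-Solver)
open import Relation.Binary.Bundles using (Setoid)
open import Relation.Binary.PropositionalEquality as ≡ using (_≡_; _≢_)
open import Relation.Binary.PropositionalEquality.Algebra using (isMagma)
open import Relation.Nullary using (yes; no)

open import Algebra.Properties.Group ℚₚ.+-0-group using (⁻¹-involutive; x∙y⁻¹≈ε⇒x≈y; ∙-cancelˡ)
open +-*-Solver using (solve; _:=_; _:+_; _:*_)

-- The common meadow ℚ ∪ {⊥}

module _ {A : Set} {f : A → A → A} where

  zipWith-assoc : Associative _≡_ f → Associative _≡_ (zipWith f)
  zipWith-assoc assoc (just x) (just y) (just z) = ≡.cong just (assoc x y z)
  zipWith-assoc assoc nothing  _        _        = ≡.refl
  zipWith-assoc assoc (just _) nothing  _        = ≡.refl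
  zipWith-assoc assoc (just _) (just _) nothing  = ≡.refl

  zipWith-comm : Commutative _≡_ f → Commutative _≡_ (zipWith f)
  zipWith-comm comm (just x) (just y) = ≡.cong just (comm x y)
  zipWith-comm comm nothing  nothing  = ≡.refl
  zipWith-comm comm nothing  (just _) = ≡.refl
  zipWith-comm comm (just _) nothing  = ≡.refl

  zipWith-nothingʳ : ∀ a → zipWith f a nothing ≡ nothing
  zipWith-nothingʳ nothing  = ≡.refl
  zipWith-nothingʳ (just _) = ≡.refl

  zipWith-distribˡ : ∀ {g : A → A → A} → (∀ x y z → f x (g y z) ≡ g (f x y) (f x z)) →
                     ∀ a b c → zipWith f a (zipWith g b c) ≡ zipWith g (zipWith f a b) (zipWith f a c)
  zipWith-distribˡ dist (just x) (just y) (just z) = ≡.cong just (dist x y z)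
  zipWith-distribˡ dist nothing  _        _        = ≡.refl
  zipWith-distribˡ dist (just _) nothing  _        = ≡.refl
  zipWith-distribˡ dist (just _) (just _) nothing  = ≡.refl

  zipWith-isCommutativeSemigroup : IsCommutativeSemigroup _≡_ f → IsCommutativeSemigroup _≡_ (zipWith f)
  zipWith-isCommutativeSemigroup isCS = record
    { isSemigroup = record { isMagma = isMagma (zipWith f) ; assoc = zipWith-assoc assoc }
    ; comm        = zipWith-comm comm
    }
    where open IsCommutativeSemigroup isCS using (assoc; comm)

ℚ⊥ : Set
ℚ⊥ = Maybe ℚ

infixl 6 _+⊥_
infixl 7 _*⊥_ _÷⊥_

_+⊥_ _*⊥_ : ℚ⊥ → ℚ⊥ → ℚ⊥
_+⊥_ = zipWith _+_
_*⊥_ = zipWith _*_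

-⊥_ : ℚ⊥ → ℚ⊥
-⊥_ = map (-_)

reciprocal : ℚ → ℚ⊥
reciprocal p with p ≟ 0ℚ
... | yes _  = nothing
... | no p≢0 = just ((1/ p) {{≢-nonZero p≢0}})

_÷⊥_ : ℚ⊥ → ℚ⊥ → ℚ⊥
a ÷⊥ b = a *⊥ (b >>= reciprocal)

⟦_⟧ : Term → ℚ⊥
⟦ `0 ⟧     = just 0ℚ
⟦ `1 ⟧     = just 1ℚ
⟦ `⊥ ⟧     = nothing
⟦ `- t ⟧   = -⊥ ⟦ t ⟧
⟦ s `+ t ⟧ = ⟦ s ⟧ +⊥ ⟦ t ⟧
⟦ s `· t ⟧ = ⟦ s ⟧ *⊥ ⟦ t ⟧
⟦ s `÷ t ⟧ = ⟦ s ⟧ ÷⊥ ⟦ t ⟧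

data ReciprocalView (p : ℚ) : ℚ⊥ → Set where
  undefined : p ≡ 0ℚ → ReciprocalView p nothing
  inverse   : ∀ {r} → p * r ≡ 1ℚ → ReciprocalView p (just r)

reciprocal-view : ∀ p → ReciprocalView p (reciprocal p)
reciprocal-view p with p ≟ 0ℚ
... | yes p≡0 = undefined p≡0
... | no p≢0  = inverse (ℚₚ.*-inverseʳ p {{≢-nonZero p≢0}})

p*q≢0 : ∀ {p q} → p ≢ 0ℚ → q ≢ 0ℚ → p * q ≢ 0ℚ
p*q≢0 {p} {q} p≢0 q≢0 pq≡0 = q≢0 (begin
  q                ≡⟨ ℚₚ.*-identityˡ q ⟨
  1ℚ * q           ≡⟨ ≡.cong (_* q) (ℚₚ.*-inverseˡ p) ⟨
  (1/ p * p) * q   ≡⟨ ℚₚ.*-assoc (1/ p) p q ⟩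
  1/ p * (p * q)   ≡⟨ ≡.cong (1/ p *_) pq≡0 ⟩
  1/ p * 0ℚ        ≡⟨ ℚₚ.*-zeroʳ (1/ p) ⟩
  0ℚ               ∎)
  where open ≡.≡-Reasoning
        instance _ = ≢-nonZero p≢0

inverse⇒≢0 : ∀ {p r} → p * r ≡ 1ℚ → p ≢ 0ℚ
inverse⇒≢0 {p} {r} pr≡1 p≡0 = ℚₚ.1≢0 (≡.trans (≡.sym pr≡1) (≡.trans (≡.cong (_* r) p≡0) (ℚₚ.*-zeroˡ r)))

inverse-unique : ∀ {p r s} → p * r ≡ 1ℚ → p * s ≡ 1ℚ → r ≡ s
inverse-unique {p} {r} {s} pr≡1 ps≡1 = begin
  r             ≡⟨ ℚₚ.*-identityʳ r ⟨
  r * 1ℚ        ≡⟨ ≡.cong (r *_) ps≡1 ⟨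
  r * (p * s)   ≡⟨ solve 3 (λ p r s → r :* (p :* s) := (p :* r) :* s) ≡.refl p r s ⟩
  (p * r) * s   ≡⟨ ≡.cong (_* s) pr≡1 ⟩
  1ℚ * s        ≡⟨ ℚₚ.*-identityˡ s ⟩
  s             ∎
  where open ≡.≡-Reasoning

inverse-* : ∀ {p q r s} → p * r ≡ 1ℚ → q * s ≡ 1ℚ → (p * q) * (r * s) ≡ 1ℚ
inverse-* {p} {q} {r} {s} pr≡1 qs≡1 = begin
  (p * q) * (r * s)   ≡⟨ solve 4 (λ p q r s → (p :* q) :* (r :* s) := (p :* r) :* (q :* s)) ≡.refl p q r s ⟩
  (p * r) * (q * s)   ≡⟨ ≡.cong₂ _*_ pr≡1 qs≡1 ⟩
  1ℚ                  ∎
  where open ≡.≡-Reasoning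

reciprocal-* : ∀ p q → reciprocal (p * q) ≡ reciprocal p *⊥ reciprocal q
reciprocal-* p q with reciprocal p | reciprocal-view p | reciprocal q | reciprocal-view q
                    | reciprocal (p * q) | reciprocal-view (p * q)
... | nothing | undefined _  | _       | _            | nothing | _ = ≡.refl
... | just _  | inverse _    | nothing | undefined _  | nothing | _ = ≡.refl
... | just r  | inverse pr≡1 | just s  | inverse qs≡1 | nothing | undefined pq≡0 =
  ⊥-elim (p*q≢0 (inverse⇒≢0 {p} {r} pr≡1) (inverse⇒≢0 {q} {s} qs≡1) pq≡0)
... | just r  | inverse pr≡1 | just s  | inverse qs≡1 | just t  | inverse pqt≡1 =
  ≡.cong just (inverse-unique {p * q} pqt≡1 (inverse-* {p} {q} {r} {s} pr≡1 qs≡1))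
... | nothing | undefined p≡0 | _       | _            | just t  | inverse pqt≡1 =
  ⊥-elim (inverse⇒≢0 {p * q} {t} pqt≡1 (≡.trans (≡.cong (_* q) p≡0) (ℚₚ.*-zeroˡ q)))
... | just _  | inverse _    | nothing | undefined q≡0 | just t  | inverse pqt≡1 =
  ⊥-elim (inverse⇒≢0 {p * q} {t} pqt≡1 (≡.trans (≡.cong (p *_) q≡0) (ℚₚ.*-zeroʳ p)))

*⊥-commutativeSemigroup : CommutativeSemigroup _ _
*⊥-commutativeSemigroup = record
  { isCommutativeSemigroup =
      zipWith-isCommutativeSemigroup (IsCommutativeMonoid.isCommutativeSemigroup ℚₚ.*-1-isCommutativeMonoid)
  }

open CommutativeSemigroupProperties *⊥-commutativeSemigroup using ()
  renaming (interchange to *⊥-interchange)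

>>=reciprocal-*⊥ : ∀ a b → ((a *⊥ b) >>= reciprocal) ≡ (a >>= reciprocal) *⊥ (b >>= reciprocal)
>>=reciprocal-*⊥ nothing  _        = ≡.refl
>>=reciprocal-*⊥ (just p) nothing  = ≡.sym (zipWith-nothingʳ (reciprocal p))
>>=reciprocal-*⊥ (just p) (just q) = reciprocal-* p q

+⊥-idʳ : ∀ a → a +⊥ just 0ℚ ≡ a
+⊥-idʳ nothing  = ≡.refl
+⊥-idʳ (just p) = ≡.cong just (ℚₚ.+-identityʳ p)

+⊥-inv : ∀ a → a +⊥ -⊥ a ≡ just 0ℚ *⊥ a
+⊥-inv nothing  = ≡.refl
+⊥-inv (just p) = ≡.cong just (≡.trans (ℚₚ.+-inverseʳ p) (≡.sym (ℚₚ.*-zeroˡ p)))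

*⊥-idˡ : ∀ a → just 1ℚ *⊥ a ≡ a
*⊥-idˡ nothing  = ≡.refl
*⊥-idˡ (just p) = ≡.cong just (ℚₚ.*-identityˡ p)

-⊥-invol : ∀ a → -⊥ (-⊥ a) ≡ a
-⊥-invol nothing  = ≡.refl
-⊥-invol (just p) = ≡.cong just (⁻¹-involutive p)

0*⊥-sq : ∀ a → just 0ℚ *⊥ (a *⊥ a) ≡ just 0ℚ *⊥ a
0*⊥-sq nothing  = ≡.refl
0*⊥-sq (just p) = ≡.cong just (≡.trans (ℚₚ.*-zeroˡ (p * p)) (≡.sym (ℚₚ.*-zeroˡ p)))

÷⊥-one : ∀ a → a ≡ a ÷⊥ just 1ℚ
÷⊥-one nothing  = ≡.refl
÷⊥-one (just p) = ≡.cong just (≡.sym (ℚₚ.*-identityʳ p))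

÷⊥-mul : ∀ x y u v → (x ÷⊥ y) *⊥ (u ÷⊥ v) ≡ (x *⊥ u) ÷⊥ (y *⊥ v)
÷⊥-mul x y u v = begin
  (x *⊥ y′) *⊥ (u *⊥ v′)   ≡⟨ *⊥-interchange x y′ u v′ ⟩
  (x *⊥ u) *⊥ (y′ *⊥ v′)   ≡⟨ ≡.cong (x *⊥ u *⊥_) (>>=reciprocal-*⊥ y v) ⟨
  (x *⊥ u) ÷⊥ (y *⊥ v)     ∎
  where open ≡.≡-Reasoning
        y′ = y >>= reciprocal
        v′ = v >>= reciprocal

÷⊥-add : ∀ x y u v → (x ÷⊥ y) +⊥ (u ÷⊥ v) ≡ (x *⊥ v +⊥ y *⊥ u) ÷⊥ (y *⊥ v)
÷⊥-add nothing  _        _        _        = ≡.refl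
÷⊥-add (just x) nothing  _        _        = ≡.sym (zipWith-nothingʳ _)
÷⊥-add (just x) (just y) u        nothing  =
  ≡.trans (≡.cong (just x ÷⊥ just y +⊥_) (zipWith-nothingʳ u)) (zipWith-nothingʳ _)
÷⊥-add (just x) (just y) nothing  (just v) = zipWith-nothingʳ _
÷⊥-add (just x) (just y) (just u) (just v) rewrite reciprocal-* y v
  with reciprocal y | reciprocal-view y | reciprocal v | reciprocal-view v
... | nothing | _            | _       | _            = ≡.refl
... | just _  | _            | nothing | _            = ≡.refl
... | just r  | inverse yr≡1 | just s  | inverse vs≡1 = ≡.cong just (begin
  x * r + u * s                             ≡⟨ ≡.cong₂ _+_ (ℚₚ.*-identityʳ (x * r)) (ℚₚ.*-identityʳ (u * s)) ⟨
  x * r * 1ℚ + u * s * 1ℚ                   ≡⟨ ≡.cong₂ (λ a b → x * r * a + u * s * b) vs≡1 yr≡1 ⟨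
  x * r * (v * s) + u * s * (y * r)         ≡⟨ solve 6 (λ x y u v r s → x :* r :* (v :* s) :+ u :* s :* (y :* r)
                                                          := (x :* v :+ y :* u) :* (r :* s)) ≡.refl x y u v r s ⟩
  (x * v + y * u) * (r * s)                 ∎)
  where open ≡.≡-Reasoning

+⊥-0*⊥ : ∀ a p → a +⊥ just 0ℚ *⊥ just p ≡ a
+⊥-0*⊥ a p = ≡.trans (≡.cong (λ z → a +⊥ just z) (ℚₚ.*-zeroˡ p)) (+⊥-idʳ a)

÷⊥-0 : ∀ x y z → x ÷⊥ (y +⊥ just 0ℚ *⊥ z) ≡ (x +⊥ just 0ℚ *⊥ z) ÷⊥ y
÷⊥-0 x y nothing  rewrite zipWith-nothingʳ {f = _+_} y | zipWith-nothingʳ {f = _+_} x = zipWith-nothingʳ x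
÷⊥-0 x y (just p) = ≡.trans (≡.cong (x ÷⊥_) (+⊥-0*⊥ y p)) (≡.cong (_÷⊥ y) (≡.sym (+⊥-0*⊥ x p)))

sound : ∀ {s t} → s ≈ t → ⟦ s ⟧ ≡ ⟦ t ⟧
sound refl              = ≡.refl
sound (sym e)           = ≡.sym (sound e)
sound (trans e f)       = ≡.trans (sound e) (sound f)
sound (cong- e)         = ≡.cong -⊥_ (sound e)
sound (cong+ e f)       = ≡.cong₂ _+⊥_ (sound e) (sound f)
sound (cong· e f)       = ≡.cong₂ _*⊥_ (sound e) (sound f)
sound (cong÷ e f)       = ≡.cong₂ _÷⊥_ (sound e) (sound f)
sound (+-assoc x y z)   = zipWith-assoc ℚₚ.+-assoc ⟦ x ⟧ ⟦ y ⟧ ⟦ z ⟧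
sound (+-comm x y)      = zipWith-comm ℚₚ.+-comm ⟦ x ⟧ ⟦ y ⟧
sound (+-idʳ x)         = +⊥-idʳ ⟦ x ⟧
sound (+-inv x)         = +⊥-inv ⟦ x ⟧
sound (·-assoc x y z)   = ≡.sym (zipWith-assoc ℚₚ.*-assoc ⟦ x ⟧ ⟦ y ⟧ ⟦ z ⟧)
sound (·-comm x y)      = zipWith-comm ℚₚ.*-comm ⟦ x ⟧ ⟦ y ⟧
sound (·-idˡ x)         = *⊥-idˡ ⟦ x ⟧
sound (distrib x y z)   = zipWith-distribˡ ℚₚ.*-distribˡ-+ ⟦ x ⟧ ⟦ y ⟧ ⟦ z ⟧
sound (invol x)         = -⊥-invol ⟦ x ⟧
sound (0·sq x)          = 0*⊥-sq ⟦ x ⟧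
sound (+-⊥ x)           = zipWith-nothingʳ ⟦ x ⟧
sound (÷-one x)         = ÷⊥-one ⟦ x ⟧
sound (÷-mul x y u v)   = ÷⊥-mul ⟦ x ⟧ ⟦ y ⟧ ⟦ u ⟧ ⟦ v ⟧
sound (÷-add x y u v)   = ÷⊥-add ⟦ x ⟧ ⟦ y ⟧ ⟦ u ⟧ ⟦ v ⟧
sound (÷-0 x y z)       = ÷⊥-0 ⟦ x ⟧ ⟦ y ⟧ ⟦ z ⟧
sound ⊥-def             = ≡.refl

≈-setoid : Setoid _ _
≈-setoid = record
  { Carrier       = Term
  ; _≈_           = _≈_
  ; isEquivalence = record { refl = refl ; sym = sym ; trans = trans }
  }

open import Relation.Binary.Reasoning.Setoid ≈-setoid

+-commutativeSemigroup : CommutativeSemigroup _ _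
+-commutativeSemigroup = record
  { _∙_                    = _`+_
  ; isCommutativeSemigroup = record
    { isSemigroup = record
      { isMagma = record { isEquivalence = Setoid.isEquivalence ≈-setoid ; ∙-cong = cong+ }
      ; assoc   = +-assoc
      }
    ; comm        = +-comm
    }
  }

open CommutativeSemigroupProperties +-commutativeSemigroup using ()
  renaming (interchange to +-interchange)

+-idˡ : ∀ x → `0 `+ x ≈ x
+-idˡ x = trans (+-comm `0 x) (+-idʳ x)

·-idʳ : ∀ x → x `· `1 ≈ x
·-idʳ x = trans (·-comm x `1) (·-idˡ x)

distribʳ : ∀ x y z → (y `+ z) `· x ≈ y `· x `+ z `· x
distribʳ x y z = trans (·-comm _ x) (trans (distrib x y z) (cong+ (·-comm x y) (·-comm x z)))

0·-x≈0·x : ∀ x → `0 `· (`- x) ≈ `0 `· x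
0·-x≈0·x x = begin
  `0 `· (`- x)           ≈⟨ +-inv (`- x) ⟨
  `- x `+ `- (`- x)      ≈⟨ cong+ refl (invol x) ⟩
  `- x `+ x              ≈⟨ +-comm (`- x) x ⟩
  x `+ `- x              ≈⟨ +-inv x ⟩
  `0 `· x                ∎

1-1≈0 : `1 `+ `- `1 ≈ `0
1-1≈0 = trans (+-inv `1) (·-idʳ `0)

0·0≈0 : `0 `· `0 ≈ `0
0·0≈0 = begin
  `0 `· `0                    ≈⟨ cong· refl 1-1≈0 ⟨
  `0 `· (`1 `+ `- `1)         ≈⟨ distrib `0 `1 (`- `1) ⟩
  `0 `· `1 `+ `0 `· (`- `1)   ≈⟨ cong+ refl (0·-x≈0·x `1) ⟩
  `0 `· `1 `+ `0 `· `1        ≈⟨ cong+ (·-idʳ `0) (·-idʳ `0) ⟩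
  `0 `+ `0                    ≈⟨ +-idʳ `0 ⟩
  `0                          ∎

0·0·x≈0·x : ∀ x → `0 `· (`0 `· x) ≈ `0 `· x
0·0·x≈0·x x = trans (·-assoc `0 `0 x) (cong· 0·0≈0 refl)

x+0·x≈x : ∀ x → x `+ `0 `· x ≈ x
x+0·x≈x x = begin
  x `+ `0 `· x          ≈⟨ cong+ (·-idˡ x) refl ⟨
  `1 `· x `+ `0 `· x    ≈⟨ distribʳ x `1 `0 ⟨
  (`1 `+ `0) `· x       ≈⟨ cong· (+-idʳ `1) refl ⟩
  `1 `· x               ≈⟨ ·-idˡ x ⟩
  x                     ∎

+0·-absorb : ∀ {x y} → `0 `· x ≈ `0 `· y → x `+ `0 `· y ≈ x
+0·-absorb {x} 0x≈0y = trans (cong+ refl (sym 0x≈0y)) (x+0·x≈x x)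

x-1·x≈0·x : ∀ x → x `+ (`- `1) `· x ≈ `0 `· x
x-1·x≈0·x x = begin
  x `+ (`- `1) `· x          ≈⟨ cong+ (·-idˡ x) refl ⟨
  `1 `· x `+ (`- `1) `· x    ≈⟨ distribʳ x `1 (`- `1) ⟨
  (`1 `+ `- `1) `· x         ≈⟨ cong· 1-1≈0 refl ⟩
  `0 `· x                    ∎

-x≈-1·x : ∀ x → `- x ≈ (`- `1) `· x
-x≈-1·x x = begin
  `- x                              ≈⟨ +0·-absorb (0·-x≈0·x x) ⟨
  `- x `+ `0 `· x                   ≈⟨ cong+ refl (x-1·x≈0·x x) ⟨
  `- x `+ (x `+ (`- `1) `· x)       ≈⟨ +-assoc (`- x) x _ ⟨
  (`- x `+ x) `+ (`- `1) `· x       ≈⟨ cong+ (trans (+-comm (`- x) x) (+-inv x)) refl ⟩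
  `0 `· x `+ (`- `1) `· x           ≈⟨ +-comm (`0 `· x) _ ⟩
  (`- `1) `· x `+ `0 `· x           ≈⟨ +0·-absorb 0·-1·x≈0·x ⟩
  (`- `1) `· x                      ∎
  where
  0·-1·x≈0·x : `0 `· ((`- `1) `· x) ≈ `0 `· x
  0·-1·x≈0·x = trans (·-assoc `0 (`- `1) x) (cong· (trans (0·-x≈0·x `1) (·-idʳ `0)) refl)

-‿+-comm : ∀ x y → `- x `+ `- y ≈ `- (x `+ y)
-‿+-comm x y = begin
  `- x `+ `- y                      ≈⟨ cong+ (-x≈-1·x x) (-x≈-1·x y) ⟩
  (`- `1) `· x `+ (`- `1) `· y      ≈⟨ distrib (`- `1) x y ⟨
  (`- `1) `· (x `+ y)               ≈⟨ -x≈-1·x (x `+ y) ⟨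
  `- (x `+ y)                       ∎

-‿distribˡ-· : ∀ x y → (`- x) `· y ≈ `- (x `· y)
-‿distribˡ-· x y = begin
  (`- x) `· y               ≈⟨ cong· (-x≈-1·x x) refl ⟩
  ((`- `1) `· x) `· y       ≈⟨ ·-assoc (`- `1) x y ⟨
  (`- `1) `· (x `· y)       ≈⟨ -x≈-1·x (x `· y) ⟨
  `- (x `· y)               ∎

-‿distribʳ-· : ∀ x y → x `· (`- y) ≈ `- (x `· y)
-‿distribʳ-· x y = trans (·-comm x (`- y)) (trans (-‿distribˡ-· y x) (cong- (·-comm y x)))

-x·-y≈x·y : ∀ x y → (`- x) `· (`- y) ≈ x `· y
-x·-y≈x·y x y = trans (-‿distribˡ-· x (`- y)) (trans (cong- (-‿distribʳ-· x y)) (invol (x `· y)))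

-0≈0 : `- `0 ≈ `0
-0≈0 = trans (sym (+-idˡ (`- `0))) (trans (+-inv `0) 0·0≈0)

x≈0·y⇒0·x≈x : ∀ {x y} → x ≈ `0 `· y → `0 `· x ≈ x
x≈0·y⇒0·x≈x {x} {y} x≈0·y = begin
  `0 `· x            ≈⟨ cong· refl x≈0·y ⟩
  `0 `· (`0 `· y)    ≈⟨ 0·0·x≈0·x y ⟩
  `0 `· y            ≈⟨ x≈0·y ⟨
  x                  ∎

÷≈·1÷ : ∀ x y → x `÷ y ≈ x `· (`1 `÷ y)
÷≈·1÷ x y = begin
  x `÷ y                    ≈⟨ cong÷ (·-idʳ x) (·-idˡ y) ⟨
  (x `· `1) `÷ (`1 `· y)    ≈⟨ ÷-mul x `1 `1 y ⟨
  (x `÷ `1) `· (`1 `÷ y)    ≈⟨ cong· (÷-one x) refl ⟨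
  x `· (`1 `÷ y)            ∎

y·1÷y : ∀ y → y `· (`1 `÷ y) ≈ `1 `+ `0 `· (`1 `÷ y)
y·1÷y y = begin
  y `· (`1 `÷ y)                          ≈⟨ ÷≈·1÷ y y ⟨
  y `÷ y                                  ≈⟨ cong÷ (trans (sym (+-idʳ y)) (cong+ (sym (·-idˡ y)) (sym (·-idˡ `0))))
                                                   (sym (·-idˡ y)) ⟩
  (`1 `· y `+ `1 `· `0) `÷ (`1 `· y)      ≈⟨ ÷-add `1 `1 `0 y ⟨
  `1 `÷ `1 `+ `0 `÷ y                     ≈⟨ cong+ (÷-one `1) (sym (÷≈·1÷ `0 y)) ⟨
  `1 `+ `0 `· (`1 `÷ y)                   ∎

1÷1÷ : ∀ y → `1 `÷ (`1 `÷ y) ≈ y `+ `0 `· (`1 `÷ y)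
1÷1÷ y = begin
  v                         ≈⟨ cong÷ refl (x+0·x≈x u) ⟨
  `1 `÷ (u `+ `0 `· u)      ≈⟨ ÷-0 `1 u u ⟩
  e `÷ u                    ≈⟨ ÷≈·1÷ e u ⟩
  e `· v                    ≈⟨ cong· (y·1÷y y) refl ⟨
  (y `· u) `· v             ≈⟨ ·-assoc y u v ⟨
  y `· (u `· v)             ≈⟨ cong· refl u·v≈e ⟩
  y `· e                    ≈⟨ ·-comm y e ⟩
  e `· y                    ≈⟨ distribʳ y `1 (`0 `· u) ⟩
  `1 `· y `+ (`0 `· u) `· y ≈⟨ cong+ (·-idˡ y) (trans (sym (·-assoc `0 u y)) (cong· refl (·-comm u y))) ⟩
  y `+ `0 `· (y `· u)       ≈⟨ cong+ refl (cong· refl (y·1÷y y)) ⟩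
  y `+ `0 `· e              ≈⟨ cong+ refl 0·e≈0·u ⟩
  y `+ `0 `· u              ∎
  where
  u = `1 `÷ y
  v = `1 `÷ u
  e = `1 `+ `0 `· u
  u·v≈e : u `· v ≈ e
  u·v≈e = begin
    u `· v                  ≈⟨ ÷-mul `1 y `1 u ⟩
    (`1 `· `1) `÷ (y `· u)  ≈⟨ cong÷ (·-idˡ `1) (y·1÷y y) ⟩
    `1 `÷ e                 ≈⟨ ÷-0 `1 `1 u ⟩
    e `÷ `1                 ≈⟨ ÷-one e ⟨
    e                       ∎
  0·e≈0·u : `0 `· e ≈ `0 `· u
  0·e≈0·u = trans (distrib `0 `1 (`0 `· u)) (trans (cong+ (·-idʳ `0) (0·0·x≈0·x u)) (+-idˡ (`0 `· u)))

-- The double reciprocal 1 ÷ (1 ÷ v) is v + 0 · (1 ÷ v), not v; the factor v in the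
-- numerator and denominator keeps track of whether v is 0.
1÷÷ : ∀ u v → `1 `÷ (u `÷ v) ≈ (v `· v) `÷ (u `· v)
1÷÷ u v = begin
  `1 `÷ (u `÷ v)                                    ≈⟨ cong÷ (sym (·-idˡ `1)) (÷≈·1÷ u v) ⟩
  (`1 `· `1) `÷ (u `· (`1 `÷ v))                    ≈⟨ ÷-mul `1 u `1 (`1 `÷ v) ⟨
  (`1 `÷ u) `· (`1 `÷ (`1 `÷ v))                    ≈⟨ cong· refl (1÷1÷ v) ⟩
  (`1 `÷ u) `· (v `+ `0 `· (`1 `÷ v))               ≈⟨ cong· refl (cong+ (÷-one v) (sym (÷≈·1÷ `0 v))) ⟩
  (`1 `÷ u) `· (v `÷ `1 `+ `0 `÷ v)                 ≈⟨ cong· refl (÷-add v `1 `0 v) ⟩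
  (`1 `÷ u) `· ((v `· v `+ `1 `· `0) `÷ (`1 `· v))  ≈⟨ ÷-mul `1 u _ _ ⟩
  (`1 `· (v `· v `+ `1 `· `0)) `÷ (u `· (`1 `· v))  ≈⟨ cong÷ 1·[v·v+1·0]≈v·v (cong· refl (·-idˡ v)) ⟩
  (v `· v) `÷ (u `· v)                              ∎
  where
  1·[v·v+1·0]≈v·v : `1 `· (v `· v `+ `1 `· `0) ≈ v `· v
  1·[v·v+1·0]≈v·v = trans (·-idˡ _) (trans (cong+ refl (·-idˡ `0)) (+-idʳ (v `· v)))

÷÷ : ∀ x y u v → (x `÷ y) `÷ (u `÷ v) ≈ (x `· (v `· v)) `÷ (y `· (u `· v))
÷÷ x y u v = begin
  (x `÷ y) `÷ (u `÷ v)                 ≈⟨ ÷≈·1÷ (x `÷ y) (u `÷ v) ⟩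
  (x `÷ y) `· (`1 `÷ (u `÷ v))         ≈⟨ cong· refl (1÷÷ u v) ⟩
  (x `÷ y) `· ((v `· v) `÷ (u `· v))   ≈⟨ ÷-mul x y (v `· v) (u `· v) ⟩
  (x `· (v `· v)) `÷ (y `· (u `· v))   ∎

-‿÷ : ∀ x y → `- (x `÷ y) ≈ (`- x) `÷ y
-‿÷ x y = begin
  `- (x `÷ y)                    ≈⟨ -x≈-1·x (x `÷ y) ⟩
  (`- `1) `· (x `÷ y)            ≈⟨ cong· (÷-one (`- `1)) refl ⟩
  ((`- `1) `÷ `1) `· (x `÷ y)    ≈⟨ ÷-mul (`- `1) `1 x y ⟩
  ((`- `1) `· x) `÷ (`1 `· y)    ≈⟨ cong÷ (sym (-x≈-1·x x)) (·-idˡ y) ⟩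
  (`- x) `÷ y                    ∎

⊥≈0÷0 : `⊥ ≈ `0 `÷ `0
⊥≈0÷0 = begin
  `⊥                                   ≈⟨ +-⊥ `⊥ ⟨
  `⊥ `+ `⊥                             ≈⟨ cong+ ⊥-def ⊥-def ⟩
  `1 `÷ `0 `+ `1 `÷ `0                 ≈⟨ ÷-add `1 `0 `1 `0 ⟩
  (`1 `· `0 `+ `0 `· `1) `÷ (`0 `· `0) ≈⟨ cong÷ (cong+ (·-idˡ `0) (·-idʳ `0)) 0·0≈0 ⟩
  (`0 `+ `0) `÷ `0                     ≈⟨ cong÷ (+-idʳ `0) refl ⟩
  `0 `÷ `0                             ∎

⊥≈0·⊥ : `⊥ ≈ `0 `· `⊥
⊥≈0·⊥ = begin
  `⊥                  ≈⟨ ⊥≈0÷0 ⟩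
  `0 `÷ `0            ≈⟨ ÷≈·1÷ `0 `0 ⟩
  `0 `· (`1 `÷ `0)    ≈⟨ cong· refl ⊥-def ⟨
  `0 `· `⊥            ∎

÷0≈0· : ∀ x → x `÷ `0 ≈ `0 `· (x `· `⊥)
÷0≈0· x = begin
  x `÷ `0              ≈⟨ ÷≈·1÷ x `0 ⟩
  x `· (`1 `÷ `0)      ≈⟨ cong· refl (trans (sym ⊥-def) ⊥≈0·⊥) ⟩
  x `· (`0 `· `⊥)      ≈⟨ ·-assoc x `0 `⊥ ⟩
  (x `· `0) `· `⊥      ≈⟨ cong· (·-comm x `0) refl ⟩
  (`0 `· x) `· `⊥      ≈⟨ ·-assoc `0 x `⊥ ⟨
  `0 `· (x `· `⊥)      ∎

-- Fractions of integer numerals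

⌜_⌝ : ℕ → Term
⌜ zero ⌝  = `0
⌜ suc n ⌝ = `1 `+ ⌜ n ⌝

⌜_⊖_⌝ : ℕ → ℕ → Term
⌜ m ⊖ n ⌝ = ⌜ m ⌝ `+ `- ⌜ n ⌝

0·⌜n⌝≈0 : ∀ n → `0 `· ⌜ n ⌝ ≈ `0
0·⌜n⌝≈0 zero    = 0·0≈0
0·⌜n⌝≈0 (suc n) = trans (distrib `0 `1 ⌜ n ⌝) (trans (cong+ (·-idʳ `0) (0·⌜n⌝≈0 n)) (+-idʳ `0))

⌜⌝-+ : ∀ m n → ⌜ m ⌝ `+ ⌜ n ⌝ ≈ ⌜ m +ℕ n ⌝
⌜⌝-+ zero    n = +-idˡ ⌜ n ⌝
⌜⌝-+ (suc m) n = trans (+-assoc `1 ⌜ m ⌝ ⌜ n ⌝) (cong+ refl (⌜⌝-+ m n))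

⌜⌝-· : ∀ m n → ⌜ m ⌝ `· ⌜ n ⌝ ≈ ⌜ m *ℕ n ⌝
⌜⌝-· zero    n = 0·⌜n⌝≈0 n
⌜⌝-· (suc m) n = begin
  (`1 `+ ⌜ m ⌝) `· ⌜ n ⌝              ≈⟨ distribʳ ⌜ n ⌝ `1 ⌜ m ⌝ ⟩
  `1 `· ⌜ n ⌝ `+ ⌜ m ⌝ `· ⌜ n ⌝       ≈⟨ cong+ (·-idˡ ⌜ n ⌝) (⌜⌝-· m n) ⟩
  ⌜ n ⌝ `+ ⌜ m *ℕ n ⌝                 ≈⟨ ⌜⌝-+ n (m *ℕ n) ⟩
  ⌜ n +ℕ m *ℕ n ⌝                     ∎

⌜n⊖n⌝≈0 : ∀ n → ⌜ n ⊖ n ⌝ ≈ `0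
⌜n⊖n⌝≈0 n = trans (+-inv ⌜ n ⌝) (0·⌜n⌝≈0 n)

⊖-neg : ∀ m n → `- ⌜ m ⊖ n ⌝ ≈ ⌜ n ⊖ m ⌝
⊖-neg m n = begin
  `- (⌜ m ⌝ `+ `- ⌜ n ⌝)        ≈⟨ -‿+-comm ⌜ m ⌝ (`- ⌜ n ⌝) ⟨
  `- ⌜ m ⌝ `+ `- (`- ⌜ n ⌝)     ≈⟨ cong+ refl (invol ⌜ n ⌝) ⟩
  `- ⌜ m ⌝ `+ ⌜ n ⌝             ≈⟨ +-comm (`- ⌜ m ⌝) ⌜ n ⌝ ⟩
  ⌜ n ⊖ m ⌝                     ∎

⊖-+ : ∀ m n k l → ⌜ m ⊖ n ⌝ `+ ⌜ k ⊖ l ⌝ ≈ ⌜ m +ℕ k ⊖ n +ℕ l ⌝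
⊖-+ m n k l = begin
  (⌜ m ⌝ `+ `- ⌜ n ⌝) `+ (⌜ k ⌝ `+ `- ⌜ l ⌝)   ≈⟨ +-interchange ⌜ m ⌝ (`- ⌜ n ⌝) ⌜ k ⌝ (`- ⌜ l ⌝) ⟩
  (⌜ m ⌝ `+ ⌜ k ⌝) `+ (`- ⌜ n ⌝ `+ `- ⌜ l ⌝)   ≈⟨ cong+ (⌜⌝-+ m k) (-‿+-comm ⌜ n ⌝ ⌜ l ⌝) ⟩
  ⌜ m +ℕ k ⌝ `+ `- (⌜ n ⌝ `+ ⌜ l ⌝)            ≈⟨ cong+ refl (cong- (⌜⌝-+ n l)) ⟩
  ⌜ m +ℕ k ⊖ n +ℕ l ⌝                          ∎

⊖-· : ∀ m n k l → ⌜ m ⊖ n ⌝ `· ⌜ k ⊖ l ⌝ ≈ ⌜ m *ℕ k +ℕ n *ℕ l ⊖ m *ℕ l +ℕ n *ℕ k ⌝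
⊖-· m n k l = begin
  (M `+ `- N) `· (K `+ `- L)                            ≈⟨ distrib (M `+ `- N) K (`- L) ⟩
  (M `+ `- N) `· K `+ (M `+ `- N) `· (`- L)             ≈⟨ cong+ (distribʳ K M (`- N)) (distribʳ (`- L) M (`- N)) ⟩
  (M `· K `+ (`- N) `· K) `+ (M `· (`- L) `+ (`- N) `· (`- L))
                                                         ≈⟨ cong+ (cong+ refl (-‿distribˡ-· N K))
                                                                  (trans (+-comm _ _) (cong+ (-x·-y≈x·y N L) (-‿distribʳ-· M L))) ⟩
  (M `· K `+ `- (N `· K)) `+ (N `· L `+ `- (M `· L))    ≈⟨ +-interchange (M `· K) _ (N `· L) _ ⟩
  (M `· K `+ N `· L) `+ (`- (N `· K) `+ `- (M `· L))    ≈⟨ cong+ refl (trans (+-comm _ _) (-‿+-comm (M `· L) (N `· K))) ⟩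
  (M `· K `+ N `· L) `+ `- (M `· L `+ N `· K)           ≈⟨ cong+ (⌜⌝-·-+ m k n l) (cong- (⌜⌝-·-+ m l n k)) ⟩
  ⌜ m *ℕ k +ℕ n *ℕ l ⊖ m *ℕ l +ℕ n *ℕ k ⌝               ∎
  where
  M = ⌜ m ⌝
  N = ⌜ n ⌝
  K = ⌜ k ⌝
  L = ⌜ l ⌝
  ⌜⌝-·-+ : ∀ a b c d → ⌜ a ⌝ `· ⌜ b ⌝ `+ ⌜ c ⌝ `· ⌜ d ⌝ ≈ ⌜ a *ℕ b +ℕ c *ℕ d ⌝
  ⌜⌝-·-+ a b c d = trans (cong+ (⌜⌝-· a b) (⌜⌝-· c d)) (⌜⌝-+ (a *ℕ b) (c *ℕ d))

Integral : Term → Set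
Integral t = ∃₂ λ m n → t ≈ ⌜ m ⊖ n ⌝

0-integral : Integral `0
0-integral = 0 , 0 , sym (⌜n⊖n⌝≈0 0)

1-integral : Integral `1
1-integral = 1 , 0 , sym (trans (cong+ (+-idʳ `1) -0≈0) (+-idʳ `1))

neg-integral : ∀ {s} → Integral s → Integral (`- s)
neg-integral (m , n , s≈) = n , m , trans (cong- s≈) (⊖-neg m n)

+-integral : ∀ {s t} → Integral s → Integral t → Integral (s `+ t)
+-integral (m , n , s≈) (k , l , t≈) = m +ℕ k , n +ℕ l , trans (cong+ s≈ t≈) (⊖-+ m n k l)

·-integral : ∀ {s t} → Integral s → Integral t → Integral (s `· t)
·-integral (m , n , s≈) (k , l , t≈) =
  m *ℕ k +ℕ n *ℕ l , m *ℕ l +ℕ n *ℕ k , trans (cong· s≈ t≈) (⊖-· m n k l)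

record Fraction (t : Term) : Set where
  constructor fraction
  field
    {num den}    : Term
    num-integral : Integral num
    den-integral : Integral den
    t≈num÷den    : t ≈ num `÷ den

-‿fraction : ∀ {s} → Fraction s → Fraction (`- s)
-‿fraction (fraction p q s≈) = fraction (neg-integral p) q (trans (cong- s≈) (-‿÷ _ _))

+-fraction : ∀ {s t} → Fraction s → Fraction t → Fraction (s `+ t)
+-fraction (fraction p q s≈) (fraction p′ q′ t≈) =
  fraction (+-integral (·-integral p q′) (·-integral q p′)) (·-integral q q′)
           (trans (cong+ s≈ t≈) (÷-add _ _ _ _))

·-fraction : ∀ {s t} → Fraction s → Fraction t → Fraction (s `· t)
·-fraction (fraction p q s≈) (fraction p′ q′ t≈) =
  fraction (·-integral p p′) (·-integral q q′) (trans (cong· s≈ t≈) (÷-mul _ _ _ _))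

÷-fraction : ∀ {s t} → Fraction s → Fraction t → Fraction (s `÷ t)
÷-fraction (fraction p q s≈) (fraction p′ q′ t≈) =
  fraction (·-integral p (·-integral q′ q′)) (·-integral q (·-integral p′ q′))
           (trans (cong÷ s≈ t≈) (÷÷ _ _ _ _))

toFraction : ∀ t → Fraction t
toFraction `0       = fraction 0-integral 1-integral (÷-one `0)
toFraction `1       = fraction 1-integral 1-integral (÷-one `1)
toFraction `⊥       = fraction 1-integral 0-integral ⊥-def
toFraction (`- t)   = -‿fraction (toFraction t)
toFraction (s `+ t) = +-fraction (toFraction s) (toFraction t)
toFraction (s `· t) = ·-fraction (toFraction s) (toFraction t)
toFraction (s `÷ t) = ÷-fraction (toFraction s) (toFraction t)

-- Integer numerals in ℚ ∪ {⊥}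

fromℕ : ℕ → ℚ
fromℕ zero    = 0ℚ
fromℕ (suc n) = 1ℚ + fromℕ n

fromℕ-nonNeg : ∀ n → 0ℚ ≤ fromℕ n
fromℕ-nonNeg zero    = ℚₚ.≤-refl
fromℕ-nonNeg (suc n) = ℚₚ.+-mono-≤ (ℚₚ.<⇒≤ (ℚₚ.positive⁻¹ 1ℚ)) (fromℕ-nonNeg n)

fromℕ-suc-pos : ∀ n → 0ℚ < fromℕ (suc n)
fromℕ-suc-pos n = ℚₚ.+-mono-<-≤ (ℚₚ.positive⁻¹ 1ℚ) (fromℕ-nonNeg n)

fromℕ-injective : ∀ {m n} → fromℕ m ≡ fromℕ n → m ≡ n
fromℕ-injective {zero}  {zero}  _ = ≡.refl
fromℕ-injective {zero}  {suc n} e = ⊥-elim (ℚₚ.<⇒≢ (fromℕ-suc-pos n) e)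
fromℕ-injective {suc m} {zero}  e = ⊥-elim (ℚₚ.<⇒≢ (fromℕ-suc-pos m) (≡.sym e))
fromℕ-injective {suc m} {suc n} e = ≡.cong suc (fromℕ-injective (∙-cancelˡ 1ℚ (fromℕ m) (fromℕ n) e))

⟦⌜n⌝⟧ : ∀ n → ⟦ ⌜ n ⌝ ⟧ ≡ just (fromℕ n)
⟦⌜n⌝⟧ zero    = ≡.refl
⟦⌜n⌝⟧ (suc n) = ≡.cong (just 1ℚ +⊥_) (⟦⌜n⌝⟧ n)

⟦⌜m⊖n⌝⟧ : ∀ m n → ⟦ ⌜ m ⊖ n ⌝ ⟧ ≡ just (fromℕ m - fromℕ n)
⟦⌜m⊖n⌝⟧ m n = ≡.cong₂ (λ a b → a +⊥ -⊥ b) (⟦⌜n⌝⟧ m) (⟦⌜n⌝⟧ n)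

fromℕ-⊖-≢0 : ∀ {m n} → m ≢ n → fromℕ m - fromℕ n ≢ 0ℚ
fromℕ-⊖-≢0 m≢n e = m≢n (fromℕ-injective (x∙y⁻¹≈ε⇒x≈y _ _ e))

÷⊥-defined : ∀ p {q} → q ≢ 0ℚ → just p ÷⊥ just q ≢ nothing
÷⊥-defined p {q} q≢0 with reciprocal q | reciprocal-view q
... | nothing | undefined q≡0 = λ _ → q≢0 q≡0
... | just _  | inverse _     = λ ()

1÷⌜⊖⌝÷⌜⊖⌝≉⊥ : ∀ {m n k l} → m ≢ n → k ≢ l → `1 `÷ (⌜ m ⊖ n ⌝ `÷ ⌜ k ⊖ l ⌝) ≈ `⊥ → ⊥
1÷⌜⊖⌝÷⌜⊖⌝≉⊥ {m} {n} {k} {l} m≢n k≢l 1÷P÷Q≈⊥ =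
  ÷⊥-defined (b * b) (p*q≢0 (fromℕ-⊖-≢0 m≢n) (fromℕ-⊖-≢0 k≢l)) (≡.trans ⟦Q·Q÷P·Q⟧ (sound Q·Q÷P·Q≈⊥))
  where
  P = ⌜ m ⊖ n ⌝
  Q = ⌜ k ⊖ l ⌝
  a = fromℕ m - fromℕ n
  b = fromℕ k - fromℕ l
  Q·Q÷P·Q≈⊥ : (Q `· Q) `÷ (P `· Q) ≈ `⊥
  Q·Q÷P·Q≈⊥ = trans (sym (1÷÷ P Q)) 1÷P÷Q≈⊥
  ⟦Q·Q÷P·Q⟧ : just (b * b) ÷⊥ just (a * b) ≡ ⟦ (Q `· Q) `÷ (P `· Q) ⟧
  ⟦Q·Q÷P·Q⟧ = ≡.sym (≡.cong₂ (λ x y → (y *⊥ y) ÷⊥ (x *⊥ y)) (⟦⌜m⊖n⌝⟧ m n) (⟦⌜m⊖n⌝⟧ k l))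

mainTheorem9 : ∀ (x : Term) → (`1 `÷ x ≈ `⊥) → (`0 `· x ≈ x)
mainTheorem9 x 1÷x≈⊥ with toFraction x
... | fraction {P} {Q} (m , n , P≈m⊖n) (k , l , Q≈k⊖l) x≈P÷Q with k ℕ.≟ l | m ℕ.≟ n
... | yes ≡.refl | _ = x≈0·y⇒0·x≈x (begin
  x                  ≈⟨ x≈P÷Q ⟩
  P `÷ Q             ≈⟨ cong÷ refl (trans Q≈k⊖l (⌜n⊖n⌝≈0 k)) ⟩
  P `÷ `0            ≈⟨ ÷0≈0· P ⟩
  `0 `· (P `· `⊥)    ∎)
... | no _ | yes ≡.refl = x≈0·y⇒0·x≈x (begin
  x                  ≈⟨ x≈P÷Q ⟩
  P `÷ Q             ≈⟨ cong÷ (trans P≈m⊖n (⌜n⊖n⌝≈0 m)) refl ⟩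
  `0 `÷ Q            ≈⟨ ÷≈·1÷ `0 Q ⟩
  `0 `· (`1 `÷ Q)    ∎)
... | no k≢l | no m≢n = ⊥-elim (1÷⌜⊖⌝÷⌜⊖⌝≉⊥ m≢n k≢l (begin
  `1 `÷ (⌜ m ⊖ n ⌝ `÷ ⌜ k ⊖ l ⌝)   ≈⟨ cong÷ refl (cong÷ P≈m⊖n Q≈k⊖l) ⟨
  `1 `÷ (P `÷ Q)                   ≈⟨ cong÷ refl x≈P÷Q ⟨
  `1 `÷ x                          ≈⟨ 1÷x≈⊥ ⟩
  `⊥                               ∎))
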